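{- Let $n\ge 3$ be an integer, $m:=n-1$, and let $a,b$ be non-negative integers with $a+b+1=m$. Put $\zeta_n:=\exp(2\pi\sqrt{ -1}/n)$ and for positive integers $s_1,\dots,s_m$ define $$\mathfrak Z_n(\zeta_n;;s_1,\dots,s_m):=\sum_{1\le i_1<\dots<i_m\le n-1}\frac{1}{(1-\zeta_n^{i_1})^{s_1}\cdots(1-\zeta_n^{i_m})^{s_m}}.$$ Then $$\mathfrak Z_n(\zeta_n;;\underbrace{1,\dots,1}_a,2,\underbrace{1,\dots,1}_b)+\mathfrak Z_n(\zeta_n;;\underbrace{1,\dots,1}_b,2,\underbrace{1,\dots,1}_a)=-\frac{m!\,(n-2m-3)}{(m+2)!}\binom{n-1}{m}.$$ -}

module Defs where

open import Level using (Level; _⊔_)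
open import Algebra.Bundles using (CommutativeRing)
open import Data.Nat as ℕ using (ℕ; zero; suc)
open import Data.Integer as ℤ using (ℤ; +_; -[1+_])
open import Data.List using (List; []; _∷_; map; _++_; upTo; zipWith; foldr; length)
open import Relation.Nullary using (¬_)
open import Data.Empty using (⊥)
open import Data.Product using (_×_)

record Field (c ℓ : Level) : Set (Level.suc (c ⊔ ℓ)) where
  field
    commutativeRing : CommutativeRing c ℓ
  open CommutativeRing commutativeRing public
  field
    _⁻¹      : Carrier → Carrier
    ⁻¹-inverse : ∀ x → ¬ (x ≈ 0#) → x * (x ⁻¹) ≈ 1#
    0≉1     : ¬ (0# ≈ 1#)

choose : {A : Set} → ℕ → List A → List (List A)
choose zero    _        = [] ∷ []
choose (suc k) []       = []
choose (suc k) (x ∷ xs) = map (x ∷_) (choose k xs) ++ choose (suc k) xs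

module FieldOps {c ℓ : Level} (F : Field c ℓ) where
  open Field F public

  pow : Carrier → ℕ → Carrier
  pow x zero    = 1#
  pow x (suc k) = x * pow x k

  ιℕ : ℕ → Carrier
  ιℕ zero    = 0#
  ιℕ (suc k) = 1# + ιℕ k

  ιℤ : ℤ → Carrier
  ιℤ (+ k)     = ιℕ k
  ιℤ -[1+ k ]  = - ιℕ (suc k)

  CharZero : Set ℓ
  CharZero = ∀ k → ιℕ (suc k) ≈ 0# → ⊥

  Primitive : ℕ → Carrier → Set ℓ
  Primitive n ζ = pow ζ n ≈ 1# × (∀ k → 0 ℕ.< k → k ℕ.< n → ¬ (pow ζ k ≈ 1#))

  sumF : List Carrier → Carrier
  sumF = foldr _+_ 0#

  prodF : List Carrier → Carrier
  prodF = foldr _*_ 1#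

  𝔷 : ℕ → Carrier → List ℕ → Carrier
  𝔷 n ζ s = sumF (map term (choose (length s) (map suc (upTo (n ℕ.∸ 1)))))
    where
    term : List ℕ → Carrier
    term is = prodF (zipWith (λ i sk → pow ((1# - pow ζ i) ⁻¹) sk) is s)

{-# OPTIONS --safe #-}
-- With m = n - 1 indices chosen among 1, …, n - 1, the sum defining 𝔷 has the single term
-- i_k = k. Writing u_k = (1 - ζ^k)⁻¹ and U = u_1 ⋯ u_m, the two values of 𝔷 are u_{a+1} U and
-- u_{b+1} U. Since ζ^{a+1} ζ^{b+1} = ζ^n = 1 and (1 - x)⁻¹ + (1 - x⁻¹)⁻¹ = 1, the left side is U.
-- Evaluating 1 + X + ⋯ + X^m = ∏_{k=1}^{m} (X - ζ^k) at X = 1 gives U⁻¹ = n, while, as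
-- n - 2m - 3 = -(m + 2), the right side is m! (m + 2) / (m + 2)! = 1 / n as well.
module Submission where

open import Defs
open import Level using (Level)
open import Data.Nat as ℕ using (ℕ; zero; suc)
  renaming (_+_ to _+ℕ_; _*_ to _*ℕ_; _∸_ to _∸ℕ_; _≤_ to _≤ℕ_; _! to _!ℕ)
import Data.Nat.Properties as ℕ
open import Data.Nat.Combinatorics using (_C_; nCn≡1)
open import Data.Nat.Tactic.RingSolver using (solve-∀)
open import Data.Integer as ℤ using (ℤ; +_; -[1+_]; _⊖_) renaming (_-_ to _-ℤ_)
import Data.Integer.Properties as ℤ
open import Data.List using (List; []; _∷_; _++_; map; length; zipWith; replicate; upTo; applyUpTo)
open import Data.List.Properties using (length-replicate; length-++; length-applyUpTo; map-applyUpTo; map-upTo)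
open import Data.List.Relation.Unary.All as All using (All; []; _∷_)
import Data.List.Relation.Unary.All.Properties as All
open import Data.List.Relation.Unary.AllPairs using (AllPairs; []; _∷_)
import Data.List.Relation.Unary.AllPairs.Properties as AllPairs
open import Data.Maybe using (Maybe; just; nothing)
open import Data.Product using (_,_)
open import Function using (_∘_)
open import Relation.Nullary using (¬_; yes; no)
open import Relation.Binary.PropositionalEquality as ≡ using (_≡_)
open import Algebra.Solver.Ring.AlmostCommutativeRing
  using (fromCommutativeRing; _-Raw-AlmostCommutative⟶_)

choose-too-many : ∀ {A : Set} k (xs : List A) → length xs ℕ.< k → choose k xs ≡ []
choose-too-many (suc k) []       _           = ≡.refl
choose-too-many (suc k) (x ∷ xs) (ℕ.s≤s |xs|<k)
  rewrite choose-too-many k xs |xs|<k | choose-too-many (suc k) xs (ℕ.m<n⇒m<1+n |xs|<k) = ≡.refl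

choose-all : ∀ {A : Set} (xs : List A) → choose (length xs) xs ≡ xs ∷ []
choose-all []       = ≡.refl
choose-all (x ∷ xs) rewrite choose-all xs | choose-too-many (suc (length xs)) xs ℕ.≤-refl = ≡.refl

2m+3≡[1+m]+[2+m] : ∀ m → 2 *ℕ m +ℕ 3 ≡ suc m +ℕ suc (suc m)
2m+3≡[1+m]+[2+m] = solve-∀

module FieldTheory {c ℓ : Level} (F : Field c ℓ) where
  open FieldOps F
  open import Algebra.Properties.Ring ring
    using (-0#≈0#; -‿involutive; -‿+-comm; -‿distribˡ-*; -‿distribʳ-*; x∙y⁻¹≈ε⇒x≈y)
  open import Algebra.Properties.Monoid.Mult +-monoid using (_×_; ×-homo-+)
  open import Algebra.Properties.Semiring.Mult semiring using (×1-homo-*)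
  open import Algebra.Properties.Semiring.Exp semiring using (_^_; ^-homo-*; ^-assocʳ; ^-congˡ; ^-congʳ)
  open import Algebra.Properties.CommutativeSemigroup *-commutativeSemigroup
    using (x∙yz≈y∙xz; xy∙z≈y∙xz)
  open import Algebra.Definitions _≈_ using (Congruent₂)
  open import Relation.Binary.Reasoning.Setoid setoid

  ιℕ≡×1 : ∀ k → ιℕ k ≡ k × 1#
  ιℕ≡×1 zero    = ≡.refl
  ιℕ≡×1 (suc k) = ≡.cong (_+_ 1#) (ιℕ≡×1 k)

  ιℕ-+ : ∀ p q → ιℕ (p +ℕ q) ≈ ιℕ p + ιℕ q
  ιℕ-+ p q rewrite ιℕ≡×1 (p +ℕ q) | ιℕ≡×1 p | ιℕ≡×1 q = ×-homo-+ 1# p q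

  ιℕ-* : ∀ p q → ιℕ (p *ℕ q) ≈ ιℕ p * ιℕ q
  ιℕ-* p q rewrite ιℕ≡×1 (p *ℕ q) | ιℕ≡×1 p | ιℕ≡×1 q = ×1-homo-* p q

  ιℤ-⊖ : ∀ p q → ιℤ (p ⊖ q) ≈ ιℕ p - ιℕ q
  ιℤ-⊖ p       zero    = sym (trans (+-congˡ -0#≈0#) (+-identityʳ _))
  ιℤ-⊖ zero    (suc q) = sym (+-identityˡ _)
  ιℤ-⊖ (suc p) (suc q) rewrite ℤ.[1+m]⊖[1+n]≡m⊖n p q = begin
    ιℤ (p ⊖ q)                  ≈⟨ ιℤ-⊖ p q ⟩
    ιℕ p - ιℕ q                 ≈⟨ +-congˡ (+-identityˡ _) ⟨
    ιℕ p + (0# - ιℕ q)          ≈⟨ +-congˡ (+-congʳ (-‿inverseʳ 1#)) ⟨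
    ιℕ p + ((1# - 1#) - ιℕ q)   ≈⟨ +-congˡ (+-assoc _ _ _) ⟩
    ιℕ p + (1# + (- 1# - ιℕ q)) ≈⟨ +-congˡ (+-congˡ (-‿+-comm _ _)) ⟩
    ιℕ p + (1# - (1# + ιℕ q))   ≈⟨ +-assoc _ _ _ ⟨
    (ιℕ p + 1#) - (1# + ιℕ q)   ≈⟨ +-congʳ (+-comm _ _) ⟩
    (1# + ιℕ p) - (1# + ιℕ q)   ∎

  ιℤ-neg : ∀ i → ιℤ (ℤ.- i) ≈ - ιℤ i
  ιℤ-neg (+ zero)  = sym -0#≈0#
  ιℤ-neg (+ suc n) = refl
  ιℤ-neg -[1+ n ]  = sym (-‿involutive _)

  ιℤ-+ : ∀ i j → ιℤ (i ℤ.+ j) ≈ ιℤ i + ιℤ j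
  ιℤ-+ (+ p)    (+ q)    = ιℕ-+ p q
  ιℤ-+ (+ p)    -[1+ q ] = ιℤ-⊖ p (suc q)
  ιℤ-+ -[1+ p ] (+ q)    = trans (ιℤ-⊖ q (suc p)) (+-comm _ _)
  ιℤ-+ -[1+ p ] -[1+ q ] = begin
    - ιℕ (suc (suc (p +ℕ q)))        ≡⟨ ≡.cong (λ k → - ιℕ (suc k)) (ℕ.+-suc p q) ⟨
    - ιℕ (suc p +ℕ suc q)            ≈⟨ -‿cong (ιℕ-+ (suc p) (suc q)) ⟩
    - (ιℕ (suc p) + ιℕ (suc q))      ≈⟨ -‿+-comm _ _ ⟨
    - ιℕ (suc p) + - ιℕ (suc q)      ∎

  ιℤ-*-negˡ : ∀ i j → ιℤ (i ℤ.* j) ≈ ιℤ i * ιℤ j →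
              ιℤ (ℤ.- i ℤ.* j) ≈ ιℤ (ℤ.- i) * ιℤ j
  ιℤ-*-negˡ i j ιij = begin
    ιℤ (ℤ.- i ℤ.* j)     ≡⟨ ≡.cong ιℤ (ℤ.neg-distribˡ-* i j) ⟨
    ιℤ (ℤ.- (i ℤ.* j))   ≈⟨ ιℤ-neg (i ℤ.* j) ⟩
    - ιℤ (i ℤ.* j)       ≈⟨ -‿cong ιij ⟩
    - (ιℤ i * ιℤ j)      ≈⟨ -‿distribˡ-* _ _ ⟩
    - ιℤ i * ιℤ j        ≈⟨ *-congʳ (ιℤ-neg i) ⟨
    ιℤ (ℤ.- i) * ιℤ j    ∎

  ιℤ-*-negʳ : ∀ i j → ιℤ (i ℤ.* j) ≈ ιℤ i * ιℤ j →
              ιℤ (i ℤ.* ℤ.- j) ≈ ιℤ i * ιℤ (ℤ.- j)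
  ιℤ-*-negʳ i j ιij = begin
    ιℤ (i ℤ.* ℤ.- j)     ≡⟨ ≡.cong ιℤ (ℤ.neg-distribʳ-* i j) ⟨
    ιℤ (ℤ.- (i ℤ.* j))   ≈⟨ ιℤ-neg (i ℤ.* j) ⟩
    - ιℤ (i ℤ.* j)       ≈⟨ -‿cong ιij ⟩
    - (ιℤ i * ιℤ j)      ≈⟨ -‿distribʳ-* _ _ ⟩
    ιℤ i * - ιℤ j        ≈⟨ *-congˡ (ιℤ-neg j) ⟨
    ιℤ i * ιℤ (ℤ.- j)    ∎

  ιℤ-*-pos : ∀ p j → ιℤ (+ p ℤ.* j) ≈ ιℕ p * ιℤ j
  ιℤ-*-pos p (+ q)    rewrite ≡.sym (ℤ.pos-* p q) = ιℕ-* p q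
  ιℤ-*-pos p -[1+ q ] = ιℤ-*-negʳ (+ p) (+ suc q) (ιℤ-*-pos p (+ suc q))

  ιℤ-* : ∀ i j → ιℤ (i ℤ.* j) ≈ ιℤ i * ιℤ j
  ιℤ-* (+ p)    j = ιℤ-*-pos p j
  ιℤ-* -[1+ p ] j = ιℤ-*-negˡ (+ suc p) j (ιℤ-*-pos (suc p) j)

  -- ιℤ (+ 1) is 1# + 0#, but the ring solver needs `con (+ 1)` to evaluate to 1# definitionally.
  ιℤ′ : ℤ → Carrier
  ιℤ′ (+ 1) = 1#
  ιℤ′ i     = ιℤ i

  ιℤ′≈ιℤ : ∀ i → ιℤ′ i ≈ ιℤ i
  ιℤ′≈ιℤ (+ zero)          = refl
  ιℤ′≈ιℤ (+ suc zero)      = sym (+-identityʳ 1#)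
  ιℤ′≈ιℤ (+ suc (suc k))   = refl
  ιℤ′≈ιℤ -[1+ k ]          = refl

  ιℤ′-morphism : ℤ.+-*-rawRing -Raw-AlmostCommutative⟶ fromCommutativeRing commutativeRing
  ιℤ′-morphism = record
    { ⟦_⟧    = ιℤ′
    ; +-homo = lift₂ ℤ._+_ _+_ +-cong ιℤ-+
    ; *-homo = lift₂ ℤ._*_ _*_ *-cong ιℤ-*
    ; -‿homo = λ i → trans (ιℤ′≈ιℤ (ℤ.- i))
                       (trans (ιℤ-neg i) (-‿cong (sym (ιℤ′≈ιℤ i))))
    ; 0-homo = refl
    ; 1-homo = refl
    }
    where
    lift₂ : ∀ (_⊕_ : ℤ → ℤ → ℤ) (_∙_ : Carrier → Carrier → Carrier) → Congruent₂ _∙_ →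
            (∀ i j → ιℤ (i ⊕ j) ≈ ιℤ i ∙ ιℤ j) →
            ∀ i j → ιℤ′ (i ⊕ j) ≈ ιℤ′ i ∙ ιℤ′ j
    lift₂ _⊕_ _∙_ ∙-cong ι-homo i j = trans (ιℤ′≈ιℤ (i ⊕ j))
      (trans (ι-homo i j) (∙-cong (sym (ιℤ′≈ιℤ i)) (sym (ιℤ′≈ιℤ j))))

  ιℤ′-≟ : ∀ i j → Maybe (ιℤ′ i ≈ ιℤ′ j)
  ιℤ′-≟ i j with i ℤ.≟ j
  ... | yes ≡.refl = just refl
  ... | no  _      = nothing

  open import Algebra.Solver.Ring ℤ.+-*-rawRing (fromCommutativeRing commutativeRing) ιℤ′-morphism ιℤ′-≟
    using (Polynomial; solve; _:=_; con; _:+_; _:*_; _:-_; :-_)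

  :1 : ∀ {k} → Polynomial k
  :1 = con (+ 1)

  x*y≈0⇒y≈0 : ∀ {x y} → ¬ x ≈ 0# → x * y ≈ 0# → y ≈ 0#
  x*y≈0⇒y≈0 {x} {y} x≉0 xy≈0 = begin
    y                ≈⟨ *-identityˡ y ⟨
    1# * y           ≈⟨ *-congʳ (⁻¹-inverse x x≉0) ⟨
    (x * x ⁻¹) * y   ≈⟨ xy∙z≈y∙xz x (x ⁻¹) y ⟩
    x ⁻¹ * (x * y)   ≈⟨ *-congˡ xy≈0 ⟩
    x ⁻¹ * 0#        ≈⟨ zeroʳ (x ⁻¹) ⟩
    0#               ∎

  *-inverse-unique : ∀ {x y z} → x * z ≈ 1# → y * z ≈ 1# → x ≈ y
  *-inverse-unique {x} {y} {z} xz≈1 yz≈1 = begin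
    x             ≈⟨ *-identityʳ x ⟨
    x * 1#        ≈⟨ *-congˡ yz≈1 ⟨
    x * (y * z)   ≈⟨ x∙yz≈y∙xz x y z ⟩
    y * (x * z)   ≈⟨ *-congˡ xz≈1 ⟩
    y * 1#        ≈⟨ *-identityʳ y ⟩
    y             ∎

  ∏⁻¹*∏≈1 : ∀ {A : Set} (f : A → Carrier) xs → All (λ i → ¬ f i ≈ 0#) xs →
            prodF (map (λ i → f i ⁻¹) xs) * prodF (map f xs) ≈ 1#
  ∏⁻¹*∏≈1 f []       []           = *-identityˡ 1#
  ∏⁻¹*∏≈1 f (i ∷ xs) (fi≉0 ∷ f≉0) = begin
    (f i ⁻¹ * P⁻¹) * (f i * P)
      ≈⟨ solve 4 (λ a a⁻¹ P⁻¹ P → (a⁻¹ :* P⁻¹) :* (a :* P) := (a :* a⁻¹) :* (P⁻¹ :* P))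
                 refl (f i) (f i ⁻¹) P⁻¹ P ⟩
    (f i * f i ⁻¹) * (P⁻¹ * P)   ≈⟨ *-cong (⁻¹-inverse (f i) fi≉0) (∏⁻¹*∏≈1 f xs f≉0) ⟩
    1# * 1#                      ≈⟨ *-identityˡ 1# ⟩
    1#                           ∎
    where
    P⁻¹ = prodF (map (λ i → f i ⁻¹) xs)
    P   = prodF (map f xs)

  pow≡^ : ∀ x k → pow x k ≡ x ^ k
  pow≡^ x zero    = ≡.refl
  pow≡^ x (suc k) = ≡.cong (x *_) (pow≡^ x k)

  pow-+ : ∀ x a b → pow x (a +ℕ b) ≈ pow x a * pow x b
  pow-+ x a b rewrite pow≡^ x (a +ℕ b) | pow≡^ x a | pow≡^ x b = ^-homo-* x a b

  pow-pow-comm : ∀ x a b → pow (pow x a) b ≈ pow (pow x b) a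
  pow-pow-comm x a b rewrite pow≡^ (pow x a) b | pow≡^ (pow x b) a | pow≡^ x a | pow≡^ x b =
    trans (^-assocʳ x a b) (trans (^-congʳ x (ℕ.*-comm a b)) (sym (^-assocʳ x b a)))

  pow-1# : ∀ k → pow 1# k ≈ 1#
  pow-1# zero    = refl
  pow-1# (suc k) = trans (*-identityˡ _) (pow-1# k)

  pow-cong : ∀ {x y} k → x ≈ y → pow x k ≈ pow y k
  pow-cong {x} {y} k x≈y rewrite pow≡^ x k | pow≡^ y k = ^-congˡ k x≈y

  pow≉0 : ∀ {x} k → ¬ x ≈ 0# → ¬ pow x k ≈ 0#
  pow≉0 zero    x≉0 1≈0   = 0≉1 (sym 1≈0)
  pow≉0 (suc k) x≉0 xxᵏ≈0 = pow≉0 k x≉0 (x*y≈0⇒y≈0 x≉0 xxᵏ≈0)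

  [1-x]⁻¹+[1-y]⁻¹≈1 : ∀ {x y} → x * y ≈ 1# → ¬ 1# - x ≈ 0# → ¬ 1# - y ≈ 0# →
                      (1# - x) ⁻¹ + (1# - y) ⁻¹ ≈ 1#
  [1-x]⁻¹+[1-y]⁻¹≈1 {x} {y} xy≈1 p≉0 q≉0 = begin
    p ⁻¹ + q ⁻¹
      ≈⟨ +-cong (*-identityʳ (p ⁻¹)) (*-identityʳ (q ⁻¹)) ⟨
    p ⁻¹ * 1# + q ⁻¹ * 1#
      ≈⟨ +-cong (*-congˡ (⁻¹-inverse q q≉0)) (*-congˡ (⁻¹-inverse p p≉0)) ⟨
    p ⁻¹ * (q * q ⁻¹) + q ⁻¹ * (p * p ⁻¹)
      ≈⟨ solve 4 (λ p q p⁻¹ q⁻¹ → p⁻¹ :* (q :* q⁻¹) :+ q⁻¹ :* (p :* p⁻¹) := (p⁻¹ :* q⁻¹) :* (p :+ q))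
                 refl p q (p ⁻¹) (q ⁻¹) ⟩
    (p ⁻¹ * q ⁻¹) * (p + q)
      ≈⟨ *-congˡ p+q≈pq ⟩
    (p ⁻¹ * q ⁻¹) * (p * q)
      ≈⟨ solve 4 (λ p q p⁻¹ q⁻¹ → (p⁻¹ :* q⁻¹) :* (p :* q) := (p :* p⁻¹) :* (q :* q⁻¹))
                 refl p q (p ⁻¹) (q ⁻¹) ⟩
    (p * p ⁻¹) * (q * q ⁻¹)
      ≈⟨ *-cong (⁻¹-inverse p p≉0) (⁻¹-inverse q q≉0) ⟩
    1# * 1#                               ≈⟨ *-identityˡ 1# ⟩
    1#                                    ∎
    where
    p = 1# - x
    q = 1# - y
    p+q≈pq : p + q ≈ p * q
    p+q≈pq = begin
      p + q                        ≈⟨ +-identityʳ (p + q) ⟨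
      (p + q) + 0#                 ≈⟨ +-congˡ (-‿inverseʳ 1#) ⟨
      (p + q) + (1# - 1#)          ≈⟨ +-congˡ (+-congʳ xy≈1) ⟨
      (p + q) + (x * y - 1#)       ≈⟨ solve 2 (λ x y → ((:1 :- x) :+ (:1 :- y)) :+ (x :* y :- :1)
                                                       := (:1 :- x) :* (:1 :- y)) refl x y ⟩
      p * q                        ∎

  -- A list c₀ ∷ ⋯ ∷ c_{d-1} encodes the monic polynomial c₀ + c₁ X + ⋯ + c_{d-1} X^{d-1} + X^d.
  evalMonic : List Carrier → Carrier → Carrier
  evalMonic []       x = 1#
  evalMonic (c ∷ cs) x = c + x * evalMonic cs x

  -- Synthetic division: the quotient of c ∷ cs by X - r, which does not depend on c.
  quotient : Carrier → List Carrier → List Carrier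
  quotient r []       = []
  quotient r (c ∷ cs) = evalMonic (c ∷ cs) r ∷ quotient r cs

  length-quotient : ∀ r cs → length (quotient r cs) ≡ length cs
  length-quotient r []       = ≡.refl
  length-quotient r (c ∷ cs) = ≡.cong suc (length-quotient r cs)

  evalMonic-division : ∀ r c cs x →
    evalMonic (c ∷ cs) x ≈ (x - r) * evalMonic (quotient r cs) x + evalMonic (c ∷ cs) r
  evalMonic-division r c []        x =
    solve 3 (λ c x r → c :+ x :* :1 := (x :- r) :* :1 :+ (c :+ r :* :1)) refl c x r
  evalMonic-division r c (c′ ∷ cs) x = begin
    c + x * evalMonic (c′ ∷ cs) x     ≈⟨ +-congˡ (*-congˡ (evalMonic-division r c′ cs x)) ⟩
    c + x * ((x - r) * Q + P)
      ≈⟨ solve 5 (λ c x r P Q → c :+ x :* ((x :- r) :* Q :+ P) := (x :- r) :* (P :+ x :* Q) :+ (c :+ r :* P))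
                 refl c x r P Q ⟩
    (x - r) * (P + x * Q) + (c + r * P) ∎
    where
    P = evalMonic (c′ ∷ cs) r
    Q = evalMonic (quotient r cs) x

  quotient-root : ∀ {r r′} c cs → evalMonic (c ∷ cs) r ≈ 0# → evalMonic (c ∷ cs) r′ ≈ 0# →
                  ¬ r ≈ r′ → evalMonic (quotient r cs) r′ ≈ 0#
  quotient-root {r} {r′} c cs pr≈0 pr′≈0 r≉r′ = x*y≈0⇒y≈0 r′-r≉0 (begin
    (r′ - r) * Q                          ≈⟨ +-identityʳ _ ⟨
    (r′ - r) * Q + 0#                     ≈⟨ +-congˡ pr≈0 ⟨
    (r′ - r) * Q + evalMonic (c ∷ cs) r   ≈⟨ evalMonic-division r c cs r′ ⟨
    evalMonic (c ∷ cs) r′                 ≈⟨ pr′≈0 ⟩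
    0#                                    ∎)
    where
    Q = evalMonic (quotient r cs) r′

    r′-r≉0 : ¬ r′ - r ≈ 0#
    r′-r≉0 r′-r≈0 = r≉r′ (sym (x∙y⁻¹≈ε⇒x≈y r′ r r′-r≈0))

  monic-roots⇒product : ∀ cs rs → length cs ≡ length rs →
    All (λ r → evalMonic cs r ≈ 0#) rs → AllPairs (λ r r′ → ¬ r ≈ r′) rs →
    ∀ x → evalMonic cs x ≈ prodF (map (_-_ x) rs)
  monic-roots⇒product []       []       _  []             []             x = refl
  monic-roots⇒product (c ∷ cs) (r ∷ rs) eq (pr≈0 ∷ prs≈0) (r≉rs ∷ rs-distinct) x = begin
    evalMonic (c ∷ cs) x                                 ≈⟨ evalMonic-division r c cs x ⟩
    (x - r) * evalMonic (quotient r cs) x + evalMonic (c ∷ cs) r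
                                                         ≈⟨ +-cong (*-congˡ q≈∏) pr≈0 ⟩
    (x - r) * prodF (map (_-_ x) rs) + 0#                ≈⟨ +-identityʳ _ ⟩
    (x - r) * prodF (map (_-_ x) rs)                     ∎
    where
    q≈∏ : evalMonic (quotient r cs) x ≈ prodF (map (_-_ x) rs)
    q≈∏ = monic-roots⇒product (quotient r cs) rs
      (≡.trans (length-quotient r cs) (ℕ.suc-injective eq))
      (All.zipWith (λ (pr′≈0 , r≉r′) → quotient-root c cs pr≈0 pr′≈0 r≉r′) (prs≈0 , r≉rs))
      rs-distinct x

  geometric-sum : ∀ k x → (x - 1#) * evalMonic (replicate k 1#) x ≈ pow x (suc k) - 1#
  geometric-sum zero    x = solve 1 (λ x → (x :- :1) :* :1 := x :* :1 :- :1) refl x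
  geometric-sum (suc k) x = begin
    (x - 1#) * (1# + x * G)
      ≈⟨ solve 2 (λ x G → (x :- :1) :* (:1 :+ x :* G) := (x :- :1) :+ x :* ((x :- :1) :* G)) refl x G ⟩
    (x - 1#) + x * ((x - 1#) * G)
      ≈⟨ +-congˡ (*-congˡ (geometric-sum k x)) ⟩
    (x - 1#) + x * (xᵏ⁺¹ - 1#)
      ≈⟨ solve 2 (λ x y → (x :- :1) :+ x :* (y :- :1) := x :* y :- :1) refl x xᵏ⁺¹ ⟩
    x * xᵏ⁺¹ - 1#                   ∎
    where
    G    = evalMonic (replicate k 1#) x
    xᵏ⁺¹ = pow x (suc k)

  geometric-sum-at-1 : ∀ k → evalMonic (replicate k 1#) 1# ≈ ιℕ (suc k)
  geometric-sum-at-1 zero    = sym (+-identityʳ 1#)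
  geometric-sum-at-1 (suc k) = +-congˡ (trans (*-identityˡ _) (geometric-sum-at-1 k))

  ∏-pow-ones : ∀ {A : Set} (f : A → Carrier) (g : ℕ → A) b →
    prodF (zipWith (λ i k → pow (f i) k) (applyUpTo g b) (replicate b 1))
      ≈ prodF (map f (applyUpTo g b))
  ∏-pow-ones f g zero    = refl
  ∏-pow-ones f g (suc b) = *-cong (*-identityʳ (f (g 0))) (∏-pow-ones f (g ∘ suc) b)

  ∏-pow-one-square : ∀ {A : Set} (f : A → Carrier) (g : ℕ → A) a b →
    prodF (zipWith (λ i k → pow (f i) k) (applyUpTo g (a +ℕ suc b))
                   (replicate a 1 ++ 2 ∷ replicate b 1))
      ≈ f (g a) * prodF (map f (applyUpTo g (a +ℕ suc b)))
  ∏-pow-one-square f g zero    b = begin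
    (x * (x * 1#)) * _   ≈⟨ *-cong (*-congˡ (*-identityʳ x)) (∏-pow-ones f (g ∘ suc) b) ⟩
    (x * x) * P          ≈⟨ *-assoc x x P ⟩
    x * (x * P)          ∎
    where
    x = f (g 0)
    P = prodF (map f (applyUpTo (g ∘ suc) b))
  ∏-pow-one-square f g (suc a) b = begin
    (y * 1#) * _         ≈⟨ *-cong (*-identityʳ y) (∏-pow-one-square f (g ∘ suc) a b) ⟩
    y * (x * P)          ≈⟨ x∙yz≈y∙xz y x P ⟩
    x * (y * P)          ∎
    where
    x = f (g (suc a))
    y = f (g 0)
    P = prodF (map f (applyUpTo (g ∘ suc) (a +ℕ suc b)))

  𝔷-single-term : ∀ m ζ s → length s ≡ m →
    𝔷 (suc m) ζ s ≈ prodF (zipWith (λ i k → pow ((1# - pow ζ i) ⁻¹) k) (applyUpTo suc m) s)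
  𝔷-single-term m ζ s |s|≡m = begin
    𝔷 (suc m) ζ s                 ≡⟨ ≡.cong (λ is → sumF (map term is)) choose≡ ⟩
    term (applyUpTo suc m) + 0#   ≈⟨ +-identityʳ _ ⟩
    term (applyUpTo suc m)        ∎
    where
    term : List ℕ → Carrier
    term is = prodF (zipWith (λ i k → pow ((1# - pow ζ i) ⁻¹) k) is s)

    choose≡ : choose (length s) (map suc (upTo m)) ≡ applyUpTo suc m ∷ []
    choose≡ = ≡.trans (≡.cong₂ choose |s|≡m (map-upTo suc m))
      (≡.subst (λ k → choose k (applyUpTo suc m) ≡ applyUpTo suc m ∷ []) (length-applyUpTo suc m)
        (choose-all (applyUpTo suc m)))

  𝔷-one-square : ∀ {m} ζ a b → a +ℕ suc b ≡ m →
    𝔷 (suc m) ζ (replicate a 1 ++ 2 ∷ replicate b 1)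
      ≈ (1# - pow ζ (suc a)) ⁻¹ * prodF (map (λ k → (1# - pow ζ k) ⁻¹) (applyUpTo suc m))
  𝔷-one-square ζ a b ≡.refl =
    trans (𝔷-single-term _ ζ _ length-s) (∏-pow-one-square (λ k → (1# - pow ζ k) ⁻¹) suc a b)
    where
    length-s : length (replicate a 1 ++ 2 ∷ replicate b 1) ≡ a +ℕ suc b
    length-s = ≡.trans (length-++ (replicate a 1))
      (≡.cong₂ _+ℕ_ (length-replicate a) (≡.cong suc (length-replicate b)))

  ιℕ≉0 : CharZero → ∀ k → .{{ℕ.NonZero k}} → ¬ ιℕ k ≈ 0#
  ιℕ≉0 charZero (suc k) = charZero k

  closed-form*n≈1 : CharZero → ∀ m →
    (- (ιℕ (m !ℕ) * ιℤ ((+ suc m) -ℤ (+ (2 *ℕ m +ℕ 3))) * (ιℕ ((m +ℕ 2) !ℕ)) ⁻¹) * ιℕ (m C m))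
      * ιℕ (suc m) ≈ 1#
  closed-form*n≈1 charZero m = begin
    (- (M * ιℤ ((+ suc m) -ℤ (+ (2 *ℕ m +ℕ 3))) * D ⁻¹) * ιℕ (m C m)) * N₁
      ≈⟨ *-congʳ (*-cong (-‿cong (*-congʳ (*-congˡ ι[n-[2m+3]]≈-N₂))) ιℕ[mCm]≈1) ⟩
    (- (M * - N₂ * D ⁻¹) * 1#) * N₁
      ≈⟨ solve 4 (λ M N₁ N₂ D⁻¹ → (:- (M :* :- N₂ :* D⁻¹) :* :1) :* N₁ := (N₂ :* (N₁ :* M)) :* D⁻¹)
                 refl M N₁ N₂ (D ⁻¹) ⟩
    (N₂ * (N₁ * M)) * D ⁻¹   ≈⟨ *-congʳ D≈N₂N₁M ⟨
    D * D ⁻¹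
      ≈⟨ ⁻¹-inverse D (ιℕ≉0 charZero ((m +ℕ 2) !ℕ) {{(m +ℕ 2) ℕ.!≢0}}) ⟩
    1#                       ∎
    where
    M  = ιℕ (m !ℕ)
    N₁ = ιℕ (suc m)
    N₂ = ιℕ (suc (suc m))
    D  = ιℕ ((m +ℕ 2) !ℕ)

    D≈N₂N₁M : D ≈ N₂ * (N₁ * M)
    D≈N₂N₁M = ≡.subst (λ k → ιℕ (k !ℕ) ≈ N₂ * (N₁ * M)) (ℕ.+-comm 2 m)
      (trans (ιℕ-* (suc (suc m)) (suc m *ℕ m !ℕ)) (*-congˡ (ιℕ-* (suc m) (m !ℕ))))

    ι[n-[2m+3]]≈-N₂ : ιℤ ((+ suc m) -ℤ (+ (2 *ℕ m +ℕ 3))) ≈ - N₂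
    ι[n-[2m+3]]≈-N₂ = begin
      ιℤ (+ suc m ℤ.+ ℤ.- + k)        ≈⟨ ιℤ-+ (+ suc m) (ℤ.- + k) ⟩
      N₁ + ιℤ (ℤ.- + k)               ≈⟨ +-congˡ (ιℤ-neg (+ k)) ⟩
      N₁ - ιℕ k                       ≡⟨ ≡.cong (λ k → N₁ - ιℕ k) (2m+3≡[1+m]+[2+m] m) ⟩
      N₁ - ιℕ (suc m +ℕ suc (suc m))  ≈⟨ +-congˡ (-‿cong (ιℕ-+ (suc m) (suc (suc m)))) ⟩
      N₁ - (N₁ + N₂)                  ≈⟨ solve 2 (λ N₁ N₂ → N₁ :- (N₁ :+ N₂) := :- N₂) refl N₁ N₂ ⟩
      - N₂                            ∎
      where
      k = 2 *ℕ m +ℕ 3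

    ιℕ[mCm]≈1 : ιℕ (m C m) ≈ 1#
    ιℕ[mCm]≈1 = ≡.subst (λ k → ιℕ k ≈ 1#) (≡.sym (nCn≡1 m)) (+-identityʳ 1#)

  module PrimitiveRoot (m : ℕ) (ζ : Carrier) (ζⁿ≈1 : pow ζ (suc m) ≈ 1#)
                       (ζᵏ≉1 : ∀ k → 0 ℕ.< k → k ℕ.< suc m → ¬ pow ζ k ≈ 1#) where

    ζ≉0 : ¬ ζ ≈ 0#
    ζ≉0 ζ≈0 = 0≉1 (begin
      0#              ≈⟨ zeroˡ (pow ζ m) ⟨
      0# * pow ζ m    ≈⟨ *-congʳ ζ≈0 ⟨
      pow ζ (suc m)   ≈⟨ ζⁿ≈1 ⟩
      1#              ∎)

    ζⁱ⁺ᵈ≉ζⁱ : ∀ i {d} → 0 ℕ.< d → d ℕ.< suc m → ¬ pow ζ (i +ℕ d) ≈ pow ζ i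
    ζⁱ⁺ᵈ≉ζⁱ i {d} 0<d d<n ζⁱ⁺ᵈ≈ζⁱ =
      ζᵏ≉1 d 0<d d<n (x∙y⁻¹≈ε⇒x≈y _ _ (x*y≈0⇒y≈0 (pow≉0 i ζ≉0) ζⁱ[ζᵈ-1]≈0))
      where
      ζⁱ[ζᵈ-1]≈0 : pow ζ i * (pow ζ d - 1#) ≈ 0#
      ζⁱ[ζᵈ-1]≈0 = begin
        pow ζ i * (pow ζ d - 1#)
          ≈⟨ solve 2 (λ a b → a :* (b :- :1) := a :* b :- a) refl (pow ζ i) (pow ζ d) ⟩
        pow ζ i * pow ζ d - pow ζ i   ≈⟨ +-congʳ (pow-+ ζ i d) ⟨
        pow ζ (i +ℕ d) - pow ζ i      ≈⟨ +-congʳ ζⁱ⁺ᵈ≈ζⁱ ⟩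
        pow ζ i - pow ζ i             ≈⟨ -‿inverseʳ (pow ζ i) ⟩
        0#                            ∎

    1-ζᵏ≉0 : ∀ {k} → 0 ℕ.< k → k ℕ.< suc m → ¬ 1# - pow ζ k ≈ 0#
    1-ζᵏ≉0 {k} 0<k k<n 1-ζᵏ≈0 = ζᵏ≉1 k 0<k k<n (sym (x∙y⁻¹≈ε⇒x≈y _ _ 1-ζᵏ≈0))

    ζᵏ-root : ∀ {k} → 0 ℕ.< k → k ℕ.< suc m → evalMonic (replicate m 1#) (pow ζ k) ≈ 0#
    ζᵏ-root {k} 0<k k<n = x*y≈0⇒y≈0 ζᵏ-1≉0 (begin
      (pow ζ k - 1#) * evalMonic (replicate m 1#) (pow ζ k) ≈⟨ geometric-sum m (pow ζ k) ⟩
      pow (pow ζ k) (suc m) - 1#    ≈⟨ +-congʳ (pow-pow-comm ζ k (suc m)) ⟩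
      pow (pow ζ (suc m)) k - 1#    ≈⟨ +-congʳ (trans (pow-cong k ζⁿ≈1) (pow-1# k)) ⟩
      1# - 1#                       ≈⟨ -‿inverseʳ 1# ⟩
      0#                            ∎)
      where
      ζᵏ-1≉0 : ¬ pow ζ k - 1# ≈ 0#
      ζᵏ-1≉0 ζᵏ-1≈0 = ζᵏ≉1 k 0<k k<n (x∙y⁻¹≈ε⇒x≈y _ _ ζᵏ-1≈0)

    ∏[1-ζᵏ]≈n : prodF (map (λ k → 1# - pow ζ k) (applyUpTo suc m)) ≈ ιℕ (suc m)
    ∏[1-ζᵏ]≈n = sym (begin
      ιℕ (suc m)
        ≈⟨ geometric-sum-at-1 m ⟨
      evalMonic (replicate m 1#) 1#
        ≈⟨ monic-roots⇒product (replicate m 1#) roots same-length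
             (All.applyUpTo⁺₁ _ m λ i<m → ζᵏ-root ℕ.z<s (ℕ.s≤s i<m))
             (AllPairs.applyUpTo⁺₁ _ m distinct) 1# ⟩
      prodF (map (_-_ 1#) roots)
        ≡⟨ ≡.cong prodF (map-applyUpTo _ (_-_ 1#) m) ⟩
      prodF (applyUpTo (λ i → 1# - pow ζ (suc i)) m)
        ≡⟨ ≡.cong prodF (map-applyUpTo suc (λ k → 1# - pow ζ k) m) ⟨
      prodF (map (λ k → 1# - pow ζ k) (applyUpTo suc m))
        ∎)
      where
      roots : List Carrier
      roots = applyUpTo (λ i → pow ζ (suc i)) m

      same-length : length (replicate m 1#) ≡ length roots
      same-length = ≡.trans (length-replicate m) (≡.sym (length-applyUpTo _ m))

      distinct : ∀ {i j} → i ℕ.< j → j ℕ.< m → ¬ pow ζ (suc i) ≈ pow ζ (suc j)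
      distinct {i} {j} i<j j<m ζ¹⁺ⁱ≈ζ¹⁺ʲ = ζⁱ⁺ᵈ≉ζⁱ (suc i) (ℕ.m<n⇒0<n∸m i<j) j∸i<n
        (≡.subst (λ k → pow ζ (suc k) ≈ pow ζ (suc i)) (≡.sym (ℕ.m+[n∸m]≡n (ℕ.<⇒≤ i<j)))
          (sym ζ¹⁺ⁱ≈ζ¹⁺ʲ))
        where
        j∸i<n : j ∸ℕ i ℕ.< suc m
        j∸i<n = ℕ.≤-<-trans (ℕ.m∸n≤m j i) (ℕ.m<n⇒m<1+n j<m)

    𝔷-pair≈∏⁻¹ : ∀ a b → a +ℕ suc b ≡ m →
      𝔷 (suc m) ζ (replicate a 1 ++ 2 ∷ replicate b 1) + 𝔷 (suc m) ζ (replicate b 1 ++ 2 ∷ replicate a 1)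
        ≈ prodF (map (λ k → (1# - pow ζ k) ⁻¹) (applyUpTo suc m))
    𝔷-pair≈∏⁻¹ a b a+[1+b]≡m = begin
      𝔷 (suc m) ζ (replicate a 1 ++ 2 ∷ replicate b 1) + 𝔷 (suc m) ζ (replicate b 1 ++ 2 ∷ replicate a 1)
        ≈⟨ +-cong (𝔷-one-square ζ a b a+[1+b]≡m) (𝔷-one-square ζ b a b+[1+a]≡m) ⟩
      u (suc a) * U + u (suc b) * U
        ≈⟨ distribʳ U (u (suc a)) (u (suc b)) ⟨
      (u (suc a) + u (suc b)) * U
        ≈⟨ *-congʳ ([1-x]⁻¹+[1-y]⁻¹≈1 ζᵃ⁺¹ζᵇ⁺¹≈1 (1-ζᵏ≉0 ℕ.z<s (1+p<n a b a+[1+b]≡m))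
                                                 (1-ζᵏ≉0 ℕ.z<s (1+p<n b a b+[1+a]≡m))) ⟩
      1# * U                          ≈⟨ *-identityˡ U ⟩
      U                               ∎
      where
      u : ℕ → Carrier
      u k = (1# - pow ζ k) ⁻¹
      U = prodF (map u (applyUpTo suc m))

      b+[1+a]≡m : b +ℕ suc a ≡ m
      b+[1+a]≡m = ≡.trans (ℕ.+-comm b (suc a)) (≡.trans (≡.sym (ℕ.+-suc a b)) a+[1+b]≡m)

      1+p<n : ∀ p q → p +ℕ suc q ≡ m → suc p ℕ.< suc m
      1+p<n p q p+[1+q]≡m = ℕ.s≤s (≡.subst (p ℕ.<_) p+[1+q]≡m (ℕ.m<m+n p ℕ.z<s))

      ζᵃ⁺¹ζᵇ⁺¹≈1 : pow ζ (suc a) * pow ζ (suc b) ≈ 1#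
      ζᵃ⁺¹ζᵇ⁺¹≈1 = trans (sym (pow-+ ζ (suc a) (suc b)))
        (≡.subst (λ k → pow ζ (suc k) ≈ 1#) (≡.sym a+[1+b]≡m) ζⁿ≈1)

    ∏⁻¹*n≈1 : prodF (map (λ k → (1# - pow ζ k) ⁻¹) (applyUpTo suc m)) * ιℕ (suc m) ≈ 1#
    ∏⁻¹*n≈1 = trans (*-congˡ (sym ∏[1-ζᵏ]≈n))
      (∏⁻¹*∏≈1 (λ k → 1# - pow ζ k) (applyUpTo suc m)
        (All.applyUpTo⁺₁ suc m λ i<m → 1-ζᵏ≉0 ℕ.z<s (ℕ.s≤s i<m)))

proposition2 : ∀ {c ℓ : Level} (F : Field c ℓ) → let open FieldOps F in
    CharZero → (n : ℕ) → 3 ≤ℕ n → (ζ : Carrier) → Primitive n ζ →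
    (a b : ℕ) → a +ℕ b +ℕ 1 ≡ n ∸ℕ 1 →
    𝔷 n ζ (replicate a 1 ++ (2 ∷ replicate b 1)) + 𝔷 n ζ (replicate b 1 ++ (2 ∷ replicate a 1))
      ≈ - (ιℕ ((n ∸ℕ 1) !ℕ) * ιℤ ((+ n) -ℤ (+ (2 *ℕ (n ∸ℕ 1) +ℕ 3))) * (ιℕ ((n ∸ℕ 1 +ℕ 2) !ℕ)) ⁻¹) * ιℕ ((n ∸ℕ 1) C (n ∸ℕ 1))
proposition2 F charZero zero    () ζ _ a b
proposition2 F charZero (suc m) _  ζ (ζⁿ≈1 , ζᵏ≉1) a b a+b+1≡m =
  *-inverse-unique (trans (*-congʳ (𝔷-pair≈∏⁻¹ a b a+[1+b]≡m)) ∏⁻¹*n≈1) (closed-form*n≈1 charZero m)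
  where
  open FieldOps F using (trans; *-congʳ)
  open FieldTheory F
  open PrimitiveRoot m ζ ζⁿ≈1 ζᵏ≉1

  a+[1+b]≡m : a +ℕ suc b ≡ m
  a+[1+b]≡m = ≡.trans (ℕ.+-suc a b) (≡.trans (ℕ.+-comm 1 (a +ℕ b)) a+b+1≡m)
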